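{- Let $\mathcal{P}$ be a set of participants, $G$ a bounded global type, $N$ a network, $M$ a queue and $(q,\lambda,p)$ a message. If $\vdash_{\mathcal{P}} G : N\parallel (q,\lambda,p)\cdot M$ and $p\notin\mathrm{Plays}(G)$, then $\vdash_{\mathcal{P}} G : N\parallel M$.
   Context: Labels are ranged over by $\lambda$, participants by $p,q,r,s$. Processes are the possibly infinite but regular (finitely many distinct subterms) terms coinductively generated by $P ::= \mathbf{0} \mid q!\{\lambda_i.P_i\}_{i\in I} \mid q?\{\lambda_i.P_i\}_{i\in I}$, with $I$ finite and nonempty and the $\lambda_i$ pairwise distinct (output to $q$, resp. input from $q$, of one of the labels, continuing as $P_i$). $\mathrm{plays}(P)$ is the smallest set with $\mathrm{plays}(\mathbf{0})=\emptyset$ and $\mathrm{plays}(q!\{\lambda_i.P_i\}_{i\in I})=\mathrm{plays}(q?\{\lambda_i.P_i\}_{i\in I})=\{q\}\cup\bigcup_{i\in I}\mathrm{plays}(P_i)$. A message is a triple $(p,\lambda,q)$ (sender $p$, label $\lambda$, receiver $q$). A queue $M$ is a finite sequence of messages ($\emptyset$ empty, $\cdot$ concatenation), taken modulo the equivalence that swaps two adjacent messages $(p,\lambda,q)$ and $(r,\lambda',s)$ whenever $p\neq r$ or $q\neq s$. A network is $N=p_1[P_1]\parallel\cdots\parallel p_n[P_n]$ with the $p_h$ pairwise distinct and $p_h\notin\mathrm{plays}(P_h)$, taken modulo permutation of components and adding/removing components $p[\mathbf{0}]$. We write $p[P]\in N$ if $P\neq\mathbf{0}$ and $N\equiv p[P]\parallel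 N'$ for some $N'$; $\mathrm{Plays}(N)=\{p\mid p[P]\in N\}$. A session is $N\parallel M$. Communications are $pq!\lambda$ and $pq?\lambda$ with $\mathrm{play}(pq!\lambda)=\mathrm{play}(pq?\lambda)=p$. Global types are regular coinductive terms $G ::= pq!\{\lambda_i.G_i\}_{i\in I} \mid pq?\lambda.G \mid \mathsf{End}$ with $p\neq q$, $I$ nonempty, labels pairwise distinct; $pq!\{\lambda_i.G_i\}$ means $p$ sends some $\lambda_i$ to $q$ then $G_i$; $pq?\lambda.G$ means $p$ reads $\lambda$ sent by $q$ then $G$. $\mathrm{Plays}(G)$ is the smallest set with $\mathrm{Plays}(\mathsf{End})=\emptyset$, $\mathrm{Plays}(pq!\{\lambda_i.G_i\}_{i\in I})=\{p\}\cup\bigcup_i\mathrm{Plays}(G_i)$, $\mathrm{Plays}(pq?\lambda.G)=\{p\}\cup\mathrm{Plays}(G)$. $\mathrm{Paths}(G)$ is the greatest set of finite or infinite sequences of communications with $\mathrm{Paths}(\mathsf{End})=\{\epsilon\}$, $\mathrm{Paths}(pq!\{\lambda_i.G_i\}_{i\in I})=\bigcup_{i}\{pq!\lambda_i\cdot\xi\mid\xi\in\mathrm{Paths}(G_i)\}$, $\mathrm{Paths}(pq?\lambda.G)=\{pq?\lambda\cdot\xi\mid \xi\in\mathrm{Paths}(G)\}$; $\xi[n]$ is the $n$-th communication of $\xi$. $\mathrm{depth}(\xi,p)=\inf\{n\mid\mathrm{play}(\xi[n])=p\}$ (with $\inf\emptyset=\infty$); $\mathrm{depth}(G,p)=\sup\{\mathrm{depth}(\xi,p)\mid\xi\in\mathrm{Paths}(G)\}$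 if $p\in\mathrm{Plays}(G)$, and $0$ otherwise. $G$ is bounded if $\mathrm{depth}(G',p)$ is finite for every $p\in\mathrm{Plays}(G)$ and every global type $G'$ occurring in $G$. Weight of a message: $\mathrm{wg}((p,\lambda,q),G)=0$ if $G=qp?\lambda.G'$; $=\infty$ if $G=\mathsf{End}$ or $G=qp?\lambda'.G'$ with $\lambda'\neq\lambda$; $=1+\max_{i\in I}\mathrm{wg}((p,\lambda,q),G_i)$ if $G=rs!\{\lambda_i.G_i\}_{i\in I}$; $=1+\mathrm{wg}((p,\lambda,q),G')$ if $G=rs?\lambda'.G'$ with $r\neq q$ or $s\neq p$. A type configuration $G\parallel M$ is $\mathcal{P}$-sound if $\mathrm{wg}((p,\lambda,q),G)$ is finite for every message $(p,\lambda,q)$ occurring in $M$ with $\{p,q\}\subseteq\mathcal{P}$. A history $H$ is a finite set of pairs $(N\parallel M, G)$; $(N\parallel -,G)\in H$ means $(N\parallel M,G)\in H$ for some $M$; $H,(S,G)$ denotes $H\cup\{(S,G)\}$. Judgements $H\vdash_{\mathcal{P}} G : N\parallel M$ (with $G$ bounded) are derived inductively (finite derivations) by: (End) $H\vdash_{\mathcal{P}}\mathsf{End}:N\parallel M$ if $\mathrm{Plays}(N)\cap\mathcal{P}=\emptyset$ and $\mathsf{End}\parallel M$ is $\mathcal{P}$-sound. (Cycle) $H\vdash_{\mathcal{P}} G:N\parallel M$ if $(N\parallel M,G)\in H$. (Out) if $G=pq!\{\lambda_i.G_i\}_{i\in I}$, $P=q!\{\lambda_i.P_i\}_{i\in I}$,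 $G\parallel M$ is $\mathcal{P}$-sound, $(p[P]\parallel N\parallel -,G)\notin H$, $(\mathrm{Plays}(N)\setminus\mathrm{Plays}(G))\cap\mathcal{P}=\emptyset$, and $H,(p[P]\parallel N\parallel M,G)\vdash_{\mathcal{P}} G_i : p[P_i]\parallel N\parallel M\cdot(p,\lambda_i,q)$ for all $i\in I$, then $H\vdash_{\mathcal{P}} G:p[P]\parallel N\parallel M$. (In) if $G=pq?\lambda_h.G'$, $P=q?\{\lambda_i.P_i\}_{i\in I}$ with $h\in I$, $G'\parallel M$ is $\mathcal{P}$-sound, $(p[P]\parallel N\parallel -,G)\notin H$, $(\mathrm{Plays}(N)\setminus\mathrm{Plays}(G))\cap\mathcal{P}=\emptyset$, and $H,(p[P]\parallel N\parallel M,G)\vdash_{\mathcal{P}}G':p[P_h]\parallel N\parallel M$, then $H\vdash_{\mathcal{P}} G : p[P]\parallel N\parallel (q,\lambda_h,p)\cdot M$. We write $\vdash_{\mathcal{P}} G:N\parallel M$ when the judgement is derivable with empty history. -}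

module Defs where

open import Data.Nat using (ℕ; zero; suc; _≤_; _<_)
open import Data.Fin using (Fin)
open import Data.Bool using (Bool; true; false; not)
open import Data.Maybe using (Maybe; just; nothing)
open import Data.List using (List; []; _∷_; _++_; [_]; map; length; filterᵇ)
open import Data.List.Membership.Propositional using (_∈_)
open import Data.List.Relation.Unary.Any using (Any)
open import Data.List.Relation.Unary.Unique.Propositional using (Unique)
open import Data.Product using (Σ; ∃; ∃-syntax; _×_; _,_; proj₁; proj₂)
open import Data.Sum using (_⊎_)
open import Data.Unit using (⊤)
open import Data.Empty using (⊥)
open import Relation.Nullary using (¬_)
open import Relation.Binary.PropositionalEquality using (_≡_; _≢_)
open import Relation.Binary.Construct.Closure.Equivalence using (EqClosure)


module Sessions (Part Label : Set) where



  WFBr : {A : Set} → List (Label × A) → Set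
  WFBr bs = (0 < length bs) × Unique (map proj₁ bs)

  BrRel : {A B : Set} → (A → B → Set) → List (Label × A) → List (Label × B) → Set
  BrRel R bs bs' =
    (∀ {l c} → (l , c) ∈ bs → ∃[ c' ] ((l , c') ∈ bs' × R c c')) ×
    (∀ {l c'} → (l , c') ∈ bs' → ∃[ c ] ((l , c) ∈ bs × R c c'))

  -- Processes: regular (possibly infinite) terms, represented as finite
  -- graphs with a root; the tree denoted is the unfolding from the root.

  data PNode (n : ℕ) : Set where
    nil : PNode n
    out : Part → List (Label × Fin n) → PNode n
    inp : Part → List (Label × Fin n) → PNode n

  WFPNode : ∀ {n} → PNode n → Set
  WFPNode nil = ⊤
  WFPNode (out q bs) = WFBr bs
  WFPNode (inp q bs) = WFBr bs

  record PGraph : Set where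
    field
      size : ℕ
      node : Fin size → PNode size
      wf   : ∀ v → WFPNode (node v)

  record Proc : Set where
    constructor ⟨_,_⟩ₚ
    field
      graph : PGraph
      root  : Fin (PGraph.size graph)

  pnode : (P : Proc) → PNode (PGraph.size (Proc.graph P))
  pnode P = PGraph.node (Proc.graph P) (Proc.root P)

  pat : (P : Proc) → Fin (PGraph.size (Proc.graph P)) → Proc
  pat P v = ⟨ Proc.graph P , v ⟩ₚ

  isNil : Proc → Bool
  isNil P with pnode P
  ... | nil = true
  ... | out _ _ = false
  ... | inp _ _ = false

  NonNil : Proc → Set
  NonNil P = isNil P ≡ false

  -- equality of the denoted (regular) trees: existence of a bisimulation
  PNodeRel : ∀ {n m} → (Fin n → Fin m → Set) → PNode n → PNode m → Set
  PNodeRel R nil nil = ⊤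
  PNodeRel R (out q bs) (out q' bs') = q ≡ q' × BrRel R bs bs'
  PNodeRel R (inp q bs) (inp q' bs') = q ≡ q' × BrRel R bs bs'
  PNodeRel R _ _ = ⊥

  _≈ₚ_ : Proc → Proc → Set₁
  P ≈ₚ Q = Σ (Fin (PGraph.size (Proc.graph P)) → Fin (PGraph.size (Proc.graph Q)) → Set) λ R →
    R (Proc.root P) (Proc.root Q) ×
    (∀ v w → R v w → PNodeRel R (PGraph.node (Proc.graph P) v) (PGraph.node (Proc.graph Q) w))

  pchildren : ∀ {n} → PNode n → List (Fin n)
  pchildren nil = []
  pchildren (out q bs) = map proj₂ bs
  pchildren (inp q bs) = map proj₂ bs

  psubj : ∀ {n} → PNode n → Maybe Part
  psubj nil = nothing
  psubj (out q bs) = just q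
  psubj (inp q bs) = just q

  data PReach (g : PGraph) : Fin (PGraph.size g) → Fin (PGraph.size g) → Set where
    here : ∀ {v} → PReach g v v
    step : ∀ {u v w} → v ∈ pchildren (PGraph.node g u) → PReach g v w → PReach g u w

  _∈plays_ : Part → Proc → Set
  r ∈plays P = ∃[ v ] (PReach (Proc.graph P) (Proc.root P) v ×
                       psubj (PGraph.node (Proc.graph P) v) ≡ just r)

  -- Global types, again as finite graphs with a root.

  data GNode (n : ℕ) : Set where
    End  : GNode n
    send : Part → Part → List (Label × Fin n) → GNode n
    recv : Part → Part → Label → Fin n → GNode n

  WFGNode : ∀ {n} → GNode n → Set
  WFGNode End = ⊤
  WFGNode (send p q bs) = p ≢ q × WFBr bs
  WFGNode (recv p q l c) = p ≢ q

  record GGraph : Set where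
    field
      size : ℕ
      node : Fin size → GNode size
      wf   : ∀ v → WFGNode (node v)

  record Global : Set where
    constructor ⟨_,_⟩g
    field
      graph : GGraph
      root  : Fin (GGraph.size graph)

  GSize : Global → ℕ
  GSize G = GGraph.size (Global.graph G)

  gnodeAt : (G : Global) → Fin (GSize G) → GNode (GSize G)
  gnodeAt G = GGraph.node (Global.graph G)

  gnode : (G : Global) → GNode (GSize G)
  gnode G = gnodeAt G (Global.root G)

  gat : (G : Global) → Fin (GSize G) → Global
  gat G v = ⟨ Global.graph G , v ⟩g

  GNodeRel : ∀ {n m} → (Fin n → Fin m → Set) → GNode n → GNode m → Set
  GNodeRel R End End = ⊤
  GNodeRel R (send p q bs) (send p' q' bs') = p ≡ p' × q ≡ q' × BrRel R bs bs'
  GNodeRel R (recv p q l c) (recv p' q' l' c') = p ≡ p' × q ≡ q' × l ≡ l' × R c c'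
  GNodeRel R _ _ = ⊥

  _≈g_ : Global → Global → Set₁
  G ≈g G' = Σ (Fin (GSize G) → Fin (GSize G') → Set) λ R →
    R (Global.root G) (Global.root G') ×
    (∀ v w → R v w → GNodeRel R (gnodeAt G v) (gnodeAt G' w))

  gchildren : ∀ {n} → GNode n → List (Fin n)
  gchildren End = []
  gchildren (send p q bs) = map proj₂ bs
  gchildren (recv p q l c) = c ∷ []

  gsubj : ∀ {n} → GNode n → Maybe Part
  gsubj End = nothing
  gsubj (send p q bs) = just p
  gsubj (recv p q l c) = just p

  data GReach (G : Global) : Fin (GSize G) → Fin (GSize G) → Set where
    here : ∀ {v} → GReach G v v
    step : ∀ {u v w} → v ∈ gchildren (gnodeAt G u) → GReach G v w → GReach G u w

  _∈PlaysG_ : Part → Global → Set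
  r ∈PlaysG G = ∃[ v ] (GReach G (Global.root G) v × gsubj (gnodeAt G v) ≡ just r)

  data Comm : Set where
    cout : Part → Part → Label → Comm
    cin  : Part → Part → Label → Comm

  play : Comm → Part
  play (cout p q l) = p
  play (cin p q l) = p

  -- Paths(G): finite or infinite sequences ξ, encoded as ℕ → Maybe Comm
  -- (ξ n = nothing beyond the end).  ξ ∈ Paths(G) iff ξ is read along a
  -- (finite, ending in End, or infinite) walk of states from the root.
  data GStep (G : Global) : Maybe (Fin (GSize G)) → Maybe (Fin (GSize G)) → Maybe Comm → Set where
    endS  : ∀ {v} → gnodeAt G v ≡ End → GStep G (just v) nothing nothing
    sendS : ∀ {v w p q l bs} → gnodeAt G v ≡ send p q bs → (l , w) ∈ bs →
            GStep G (just v) (just w) (just (cout p q l))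
    recvS : ∀ {v w p q l} → gnodeAt G v ≡ recv p q l w →
            GStep G (just v) (just w) (just (cin p q l))
    stopS : GStep G nothing nothing nothing

  IsPath : (G : Global) → (ℕ → Maybe Comm) → Set
  IsPath G ξ = Σ (ℕ → Maybe (Fin (GSize G))) λ s → (s 0 ≡ just (Global.root G) × (∀ k → GStep G (s k) (s (suc k)) (ξ k)))

  DepthPath≤ : (ℕ → Maybe Comm) → Part → ℕ → Set
  DepthPath≤ ξ p K = ∃[ n ] (n ≤ K × ∃[ c ] (ξ n ≡ just c × play c ≡ p))

  -- depth(G,p) is finite (it is 0 when p ∉ Plays(G); otherwise it is the
  -- sup over paths, finite iff bounded by some K)
  FiniteDepth : Global → Part → Set
  FiniteDepth G p = p ∈PlaysG G → ∃[ K ] (∀ ξ → IsPath G ξ → DepthPath≤ ξ p K)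

  Bounded : Global → Set
  Bounded G = ∀ v → GReach G (Global.root G) v → ∀ p → p ∈PlaysG G → FiniteDepth (gat G v) p

  Msg : Set
  Msg = Part × Label × Part     -- (sender, label, receiver)

  Queue : Set
  Queue = List Msg

  data Swap : Queue → Queue → Set where
    swap : ∀ (M₁ M₂ : Queue) {p l q r l' s} → (p ≢ r ⊎ q ≢ s) →
           Swap (M₁ ++ (p , l , q) ∷ (r , l' , s) ∷ M₂) (M₁ ++ (r , l' , s) ∷ (p , l , q) ∷ M₂)

  _≈q_ : Queue → Queue → Set
  _≈q_ = EqClosure Swap

  -- WgFin (p,λ,q) G v : wg((p,λ,q), G at v) is finite
  -- (least-fixed-point reading of the recursive definition of wg)
  data WgFin (G : Global) (p : Part) (l : Label) (q : Part) : Fin (GSize G) → Set where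
    w-here : ∀ {v c} → gnodeAt G v ≡ recv q p l c → WgFin G p l q v
    w-send : ∀ {v r s bs} → gnodeAt G v ≡ send r s bs →
             (∀ {l' c} → (l' , c) ∈ bs → WgFin G p l q c) → WgFin G p l q v
    w-recv : ∀ {v r s l' c} → gnodeAt G v ≡ recv r s l' c → (r ≢ q ⊎ s ≢ p) →
             WgFin G p l q c → WgFin G p l q v

  Sound : (Part → Set) → Global → Queue → Set
  Sound 𝒫 G M = ∀ {p l q} → (p , l , q) ∈ M → 𝒫 p → 𝒫 q → WgFin G p l q (Global.root G)

  -- Networks, represented as lists of components, modulo the equivalence
  -- (permutation, adding/removing r[0]) captured by _≈ₙ_.

  Net : Set
  Net = List (Part × Proc)

  _[_]∈_ : Part → Proc → Net → Set₁
  r [ P ]∈ N = NonNil P × Any (λ e → Data.Product.Σ (proj₁ e ≡ r) (λ _ → proj₂ e ≈ₚ P)) N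

  _≈ₙ_ : Net → Net → Set₁
  N ≈ₙ N' = ∀ r P → (r [ P ]∈ N → r [ P ]∈ N') × (r [ P ]∈ N' → r [ P ]∈ N)

  _∈PlaysN_ : Part → Net → Set
  r ∈PlaysN N = Any (λ e → proj₁ e ≡ r × NonNil (proj₂ e)) N

  nonNilNames : Net → List Part
  nonNilNames N = map proj₁ (filterᵇ (λ e → not (isNil (proj₂ e))) N)

  WFNet : Net → Set
  WFNet N = (∀ {r P} → (r , P) ∈ N → NonNil P → ¬ (r ∈plays P)) × Unique (nonNilNames N)

  History : Set
  History = List (Net × Queue × Global)

  InH : History → Net → Queue → Global → Set₁
  InH H N M G = Any (λ e → (proj₁ e ≈ₙ N) × (proj₁ (proj₂ e) ≈q M) × (proj₂ (proj₂ e) ≈g G)) H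

  InH- : History → Net → Global → Set₁
  InH- H N G = Any (λ e → (proj₁ e ≈ₙ N) × (proj₂ (proj₂ e) ≈g G)) H

  data _⊢[_]_∶_∥_ : History → (Part → Set) → Global → Net → Queue → Set₁ where
    t-end : ∀ {H 𝒫 G N M} →
      gnode G ≡ End →
      (∀ r → r ∈PlaysN N → ¬ 𝒫 r) →
      Sound 𝒫 G M →
      H ⊢[ 𝒫 ] G ∶ N ∥ M
    t-cycle : ∀ {H 𝒫 G N M} →
      InH H N M G →
      H ⊢[ 𝒫 ] G ∶ N ∥ M
    t-out : ∀ {H 𝒫 G N₀ M p q bs P pbs N} →
      gnode G ≡ send p q bs →
      pnode P ≡ out q pbs →
      BrRel (λ _ _ → ⊤) bs pbs →                 -- same index/label set I
      Sound 𝒫 G M →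
      N₀ ≈ₙ ((p , P) ∷ N) →
      ¬ (p ∈PlaysN N) →
      ¬ InH- H ((p , P) ∷ N) G →
      (∀ r → r ∈PlaysN N → ¬ (r ∈PlaysG G) → ¬ 𝒫 r) →
      (∀ {l c c'} → (l , c) ∈ bs → (l , c') ∈ pbs →
         ((((p , P) ∷ N) , M , G) ∷ H) ⊢[ 𝒫 ] gat G c ∶ ((p , pat P c') ∷ N) ∥ (M ++ [ (p , l , q) ])) →
      H ⊢[ 𝒫 ] G ∶ N₀ ∥ M
    t-in : ∀ {H 𝒫 G N₀ M₀ M p q l c P pbs c' N} →
      gnode G ≡ recv p q l c →
      pnode P ≡ inp q pbs →
      (l , c') ∈ pbs →
      Sound 𝒫 (gat G c) M →
      N₀ ≈ₙ ((p , P) ∷ N) →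
      M₀ ≈q ((q , l , p) ∷ M) →
      ¬ (p ∈PlaysN N) →
      ¬ InH- H ((p , P) ∷ N) G →
      (∀ r → r ∈PlaysN N → ¬ (r ∈PlaysG G) → ¬ 𝒫 r) →
      ((((p , P) ∷ N) , M , G) ∷ H) ⊢[ 𝒫 ] gat G c ∶ ((p , pat P c') ∷ N) ∥ M →
      H ⊢[ 𝒫 ] G ∶ N₀ ∥ M₀

{-# OPTIONS --safe #-}
-- A message whose receiver p does not play in G is never read by any rule of the
-- derivation, so it can be removed from every queue, including the queues
-- recorded in the history (so that (Cycle) still applies).  The only delicate
-- rule is (In): the message read there is addressed to the subject of G, which
-- is not p, so the two messages commute and the read one can still be brought
-- to the front of the shortened queue.
module Submission where

open import Defs
open import Data.List using ([]; _∷_; _++_)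
open import Data.List.Properties using (++-assoc)
open import Data.List.Relation.Unary.Any using (here; there)
open import Data.List.Membership.Propositional using (_∈_)
open import Data.List.Membership.Propositional.Properties using (∈-map⁺)
open import Data.List.Relation.Binary.Permutation.Propositional using (_↭_; ↭-isEquivalence; swap)
open import Data.List.Relation.Binary.Permutation.Propositional.Properties using (++⁺ˡ; ∈-resp-↭)
open import Data.Product using (∃; _×_; _,_; proj₂)
open import Data.Sum using (_⊎_; inj₁; inj₂)
import Data.Sum as Sum
open import Function using (_∘_)
open import Relation.Nullary using (¬_; contradiction)
open import Relation.Binary.PropositionalEquality using (_≡_; _≢_; refl; sym; subst; cong; ≢-sym)
open import Relation.Binary.Construct.Closure.ReflexiveTransitive using (ε; _◅_; _◅◅_)
open import Relation.Binary.Construct.Closure.Symmetric using (SymClosure; fwd; bwd)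
import Relation.Binary.Construct.Closure.Equivalence as EqClosure

module _ (Part Label : Set) where
  open Sessions Part Label

  Independent : Msg → Msg → Set
  Independent (p , _ , q) (r , _ , s) = p ≢ r ⊎ q ≢ s

  Independent-sym : ∀ {p q r s : Part} → p ≢ r ⊎ q ≢ s → r ≢ p ⊎ s ≢ q
  Independent-sym = Sum.map ≢-sym ≢-sym

  Independent-irrefl : ∀ {p q : Part} → ¬ (p ≢ p ⊎ q ≢ q)
  Independent-irrefl (inj₁ p≢p) = p≢p refl
  Independent-irrefl (inj₂ q≢q) = q≢q refl

  ≈q-sym : ∀ {A B} → A ≈q B → B ≈q A
  ≈q-sym = EqClosure.symmetric Swap

  ≈q-swap : ∀ {A B} → Swap A B → A ≈q B
  ≈q-swap s = fwd s ◅ ε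

  ≈q-prep : ∀ c {A B} → A ≈q B → (c ∷ A) ≈q (c ∷ B)
  ≈q-prep c = EqClosure.gmap (c ∷_) λ { (swap M₁ M₂ d) → swap (c ∷ M₁) M₂ d }

  ≈q-++⁺ʳ : ∀ X {A B} → A ≈q B → (A ++ X) ≈q (B ++ X)
  ≈q-++⁺ʳ X = EqClosure.gmap (_++ X) Swap-++⁺ʳ
    where
    Swap-++⁺ʳ : ∀ {A B} → Swap A B → Swap (A ++ X) (B ++ X)
    Swap-++⁺ʳ (swap M₁ M₂ {p} {l} {q} {r} {l'} {s} d)
      rewrite ++-assoc M₁ ((p , l , q) ∷ (r , l' , s) ∷ M₂) X
            | ++-assoc M₁ ((r , l' , s) ∷ (p , l , q) ∷ M₂) X = swap M₁ (M₂ ++ X) d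

  ≈q⇒↭ : ∀ {A B} → A ≈q B → A ↭ B
  ≈q⇒↭ = EqClosure.fold ↭-isEquivalence λ { (swap M₁ M₂ _) → ++⁺ˡ M₁ (swap _ _ _↭_.refl) }

  ∈-resp-≈q : ∀ {x A B} → A ≈q B → x ∈ A → x ∈ B
  ∈-resp-≈q A≈B = ∈-resp-↭ (≈q⇒↭ A≈B)

  data Extract (m : Msg) : Queue → Queue → Set where
    here  : ∀ {R} → Extract m (m ∷ R) R
    there : ∀ {c B R} → Independent m c → Extract m B R → Extract m (c ∷ B) (c ∷ R)

  Extract⇒≈q : ∀ {m B R} → Extract m B R → B ≈q (m ∷ R)
  Extract⇒≈q here = ε
  Extract⇒≈q {_ , _ , _} (there {c@(_ , _ , _)} d e) =
    ≈q-prep c (Extract⇒≈q e) ◅◅ ≈q-swap (swap [] _ (Independent-sym d))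

  Extract-swap : ∀ {m x y M₂ R} M₁ → Independent x y → Extract m (M₁ ++ x ∷ y ∷ M₂) R →
                 ∃ λ R' → Extract m (M₁ ++ y ∷ x ∷ M₂) R' × R ≈q R'
  Extract-swap []       d here                      = _ , there d here , ε
  Extract-swap []       d (there _ here)            = _ , here , ε
  Extract-swap []       d (there dx (there dy e))   = _ , there dy (there dx e) , ≈q-swap (swap [] _ d)
  Extract-swap (c ∷ M₁) d here                      = _ , here , ≈q-swap (swap M₁ _ d)
  Extract-swap (c ∷ M₁) d (there dc e) with Extract-swap M₁ d e
  ... | R' , e' , R≈R' = c ∷ R' , there dc e' , ≈q-prep c R≈R'

  Extract-resp-SymSwap : ∀ {m B B' R} → SymClosure Swap B B' → Extract m B R →
                         ∃ λ R' → Extract m B' R' × R ≈q R'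
  Extract-resp-SymSwap (fwd (swap M₁ _ d)) = Extract-swap M₁ d
  Extract-resp-SymSwap (bwd (swap M₁ _ d)) = Extract-swap M₁ (Independent-sym d)

  Extract-resp-≈q : ∀ {m B B' R} → B ≈q B' → Extract m B R → ∃ λ R' → Extract m B' R' × R ≈q R'
  Extract-resp-≈q ε e = _ , e , ε
  Extract-resp-≈q (s ◅ B≈B') e with Extract-resp-SymSwap s e
  ... | _ , e' , R≈R' with Extract-resp-≈q B≈B' e'
  ...   | R'' , e'' , R'≈R'' = R'' , e'' , R≈R' ◅◅ R'≈R''

  ≈q-drop-∷ : ∀ {m A B} → (m ∷ A) ≈q (m ∷ B) → A ≈q B
  ≈q-drop-∷ {_ , _ , _} mA≈mB with Extract-resp-≈q mA≈mB here
  ... | _ , here , A≈B = A≈B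
  ... | _ , there d _ , _ = contradiction d Independent-irrefl

  ≈q-∷-distinct-heads : ∀ {m m' A B} → m ≢ m' → (m ∷ A) ≈q (m' ∷ B) →
                        ∃ λ R → A ≈q (m' ∷ R) × B ≈q (m ∷ R)
  ≈q-∷-distinct-heads m≢m' mA≈m'B with Extract-resp-≈q mA≈m'B here
  ... | _ , here , _ = contradiction refl m≢m'
  ... | _ , there _ e , A≈m'R = _ , A≈m'R , Extract⇒≈q e

  Sound-resp-∷ : ∀ {𝒫 G m M₁ M} → M₁ ≈q (m ∷ M) → Sound 𝒫 G M₁ → Sound 𝒫 G M
  Sound-resp-∷ M₁≈mM sound x∈M = sound (∈-resp-≈q (≈q-sym M₁≈mM) (there x∈M))

  GReach-gat : ∀ {G c u w} → GReach (gat G c) u w → GReach G u w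
  GReach-gat here = here
  GReach-gat (step i r) = step i (GReach-gat r)

  ∉PlaysG-child : ∀ {G c r} → c ∈ gchildren (gnode G) → ¬ r ∈PlaysG G → ¬ r ∈PlaysG gat G c
  ∉PlaysG-child c∈ r∉G (v , reach , subj) = r∉G (v , step c∈ (GReach-gat reach) , subj)

  ∉PlaysG-send : ∀ {G p q bs l c r} → gnode G ≡ send p q bs → (l , c) ∈ bs →
                 ¬ r ∈PlaysG G → ¬ r ∈PlaysG gat G c
  ∉PlaysG-send {G} {c = c} eG lc∈bs =
    ∉PlaysG-child {G} (subst (λ g → c ∈ gchildren g) (sym eG) (∈-map⁺ proj₂ lc∈bs))

  ∉PlaysG-recv : ∀ {G p q l c r} → gnode G ≡ recv p q l c → ¬ r ∈PlaysG G → ¬ r ∈PlaysG gat G c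
  ∉PlaysG-recv {G} {c = c} eG = ∉PlaysG-child {G} (subst (λ g → c ∈ gchildren g) (sym eG) (here refl))

  recv-≢-∉PlaysG : ∀ {G r s l' c q l p} → gnode G ≡ recv r s l' c → ¬ p ∈PlaysG G →
                   (q , l , p) ≢ (s , l' , r)
  recv-≢-∉PlaysG eG p∉G refl = p∉G (_ , here , cong gsubj eG)

  data QueuesPrefixed (m : Msg) : History → History → Set₁ where
    []  : QueuesPrefixed m [] []
    _∷_ : ∀ {N E E' G H H'} → E ≈q (m ∷ E') → QueuesPrefixed m H H' →
          QueuesPrefixed m ((N , E , G) ∷ H) ((N , E' , G) ∷ H')

  InH-drop : ∀ {m H H' N M₁ M G} → QueuesPrefixed m H H' → M₁ ≈q (m ∷ M) →
             InH H N M₁ G → InH H' N M G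
  InH-drop (E≈mE' ∷ _) M₁≈mM (here (N≈ , E≈M₁ , G≈)) =
    here (N≈ , ≈q-drop-∷ (≈q-sym E≈mE' ◅◅ E≈M₁ ◅◅ M₁≈mM) , G≈)
  InH-drop {N = N} {M₁} {G = G} (_ ∷ pre) M₁≈mM (there i) =
    there (InH-drop {N = N} {M₁ = M₁} {G = G} pre M₁≈mM i)

  InH⁻-lift : ∀ {m H H' N G} → QueuesPrefixed m H H' → InH- H' N G → InH- H N G
  InH⁻-lift (_ ∷ _) (here x) = here x
  InH⁻-lift {N = N} {G} (_ ∷ pre) (there i) = there (InH⁻-lift {N = N} {G} pre i)

  ⊢-drop-unread : ∀ {q l p H H' 𝒫 G N M₁ M} → H ⊢[ 𝒫 ] G ∶ N ∥ M₁ →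
                  QueuesPrefixed (q , l , p) H H' → M₁ ≈q ((q , l , p) ∷ M) →
                  ¬ p ∈PlaysG G → H' ⊢[ 𝒫 ] G ∶ N ∥ M
  ⊢-drop-unread {M₁ = M₁} (t-end eG 𝒫∌N sound) pre M₁≈mM p∉G =
    t-end eG 𝒫∌N (Sound-resp-∷ {M₁ = M₁} M₁≈mM sound)
  ⊢-drop-unread {G = G} {N} {M₁} (t-cycle inH) pre M₁≈mM p∉G =
    t-cycle (InH-drop {N = N} {M₁ = M₁} {G = G} pre M₁≈mM inH)
  ⊢-drop-unread {G = G} {M₁ = M₁}
    (t-out {p = r} {P = P} {N = N} eG eP br sound N₀≈ r∉N fresh 𝒫∌N branches) pre M₁≈mM p∉G =
    t-out eG eP br (Sound-resp-∷ {M₁ = M₁} M₁≈mM sound) N₀≈ r∉N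
      (fresh ∘ InH⁻-lift {N = (r , P) ∷ N} {G} pre) 𝒫∌N
      λ lc∈bs lc'∈pbs → ⊢-drop-unread (branches lc∈bs lc'∈pbs) (M₁≈mM ∷ pre) (≈q-++⁺ʳ _ M₁≈mM)
                          (∉PlaysG-send {G} eG lc∈bs p∉G)
  ⊢-drop-unread {G = G} {M₁ = M₁}
    (t-in {M = M'} {p = r} {P = P} {N = N} eG eP l∈pbs sound N₀≈ M₀≈ r∉N fresh 𝒫∌N cont) pre M₁≈mM p∉G
    with ≈q-∷-distinct-heads (recv-≢-∉PlaysG {G} eG p∉G) (≈q-sym M₁≈mM ◅◅ M₀≈)
  ... | _ , M≈ , M'≈ =
    t-in eG eP l∈pbs (Sound-resp-∷ {M₁ = M'} M'≈ sound) N₀≈ M≈ r∉N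
      (fresh ∘ InH⁻-lift {N = (r , P) ∷ N} {G} pre) 𝒫∌N
      (⊢-drop-unread cont (M'≈ ∷ pre) M'≈ (∉PlaysG-recv {G} eG p∉G))

lemma4 : (Part Label : Set) → let open Sessions Part Label in
    (𝒫 : Part → Set) (G : Global) (N : Net) (M : Queue) (q : Part) (l : Label) (p : Part) →
    Bounded G → WFNet N →
    [] ⊢[ 𝒫 ] G ∶ N ∥ ((q , l , p) ∷ M) →
    ¬ (p ∈PlaysG G) →
    [] ⊢[ 𝒫 ] G ∶ N ∥ M
lemma4 Part Label 𝒫 G N M q l p _ _ ⊢G p∉G = ⊢-drop-unread Part Label ⊢G [] ε p∉G
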